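{- Let $G$ be a connected triangle-free graph with six vertices. Then $(G,k)$ is niche-realizable for some integer $k\ge 3$ if and only if $k=3$ and $G$ is isomorphic to the cycle $C_6$ or to the graph $G_5$.
   Context: $G_5$ is the graph on vertices $x_1,\dots,x_6$ with edges $x_1x_2,x_2x_3,x_3x_4,x_4x_5,x_5x_6,x_6x_1,x_1x_4,x_2x_5,x_3x_6$ (isomorphic to $K_{3,3}$). A $k$-partite tournament is an orientation of a complete $k$-partite graph with $k$ nonempty partite sets. The niche graph $\mathcal{N}(D)$ of a digraph $D$ has vertex set $V(D)$, and two distinct vertices are adjacent iff they have a common out-neighbor in $D$ or a common in-neighbor in $D$. The pair $(G,k)$ is niche-realizable if $G$ is isomorphic to the niche graph of some $k$-partite tournament. -}

module Defs where

open import Data.Nat using (ℕ; _+_; _∸_; _%_; _≡ᵇ_)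
open import Data.Bool using (Bool; true; false; T; _∨_)
open import Data.Fin using (zero; suc)
open import Data.Fin using (Fin; toℕ)
open import Data.Product using (Σ; ∃; _×_; _,_)
open import Data.Sum using (_⊎_)
open import Data.Empty using (⊥)
open import Relation.Nullary using (¬_)
open import Relation.Binary.PropositionalEquality using (_≡_; _≢_; refl; subst)
open import Function using (Surjective)
open import Function.Bundles using (_↔_; Inverse)

record Graph (n : ℕ) : Set₁ where
  field
    Adj    : Fin n → Fin n → Set
    sym    : ∀ {x y} → Adj x y → Adj y x
    irrefl : ∀ {x} → ¬ Adj x x
open Graph public

data Reach {n : ℕ} (G : Graph n) : Fin n → Fin n → Set where
  here : ∀ {x} → Reach G x x
  step : ∀ {x y z} → Adj G x y → Reach G y z → Reach G x z

Connected : ∀ {n} → Graph n → Set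
Connected G = ∀ x y → Reach G x y

TriangleFree : ∀ {n} → Graph n → Set
TriangleFree G = ∀ x y z → ¬ (Adj G x y × Adj G y z × Adj G x z)

_≅_ : ∀ {n m} → Graph n → Graph m → Set
_≅_ {n} {m} G H = Σ (Fin n ↔ Fin m) λ f →
  ∀ x y → (Adj G x y → Adj H (Inverse.to f x) (Inverse.to f y))
        × (Adj H (Inverse.to f x) (Inverse.to f y) → Adj G x y)

Digraph : ℕ → Set₁
Digraph n = Fin n → Fin n → Set

-- D is a k-partite tournament: there is a partition of the vertices into k
-- nonempty partite sets (a surjection part : Fin n → Fin k) such that D is an
-- orientation of the complete k-partite graph: no arcs inside a partite set, and
-- between vertices of different partite sets exactly one of the two arcs.
IsKPartiteTournament : ∀ {n} → ℕ → Digraph n → Set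
IsKPartiteTournament {n} k D = Σ (Fin n → Fin k) λ part →
    Surjective _≡_ _≡_ part
  × (∀ x y → part x ≡ part y → ¬ D x y)
  × (∀ x y → part x ≢ part y → (D x y × ¬ D y x) ⊎ (D y x × ¬ D x y))

NicheAdj : ∀ {n} → Digraph n → Fin n → Fin n → Set
NicheAdj D x y = x ≢ y × ((∃ λ z → D x z × D y z) ⊎ (∃ λ z → D z x × D z y))

Niche : ∀ {n} → Digraph n → Graph n
Niche D = record
  { Adj = NicheAdj D
  ; sym = λ { (x≢y , Data.Sum.inj₁ (z , a , b)) → (λ e → x≢y (Relation.Binary.PropositionalEquality.sym e)) , Data.Sum.inj₁ (z , b , a)
            ; (x≢y , Data.Sum.inj₂ (z , a , b)) → (λ e → x≢y (Relation.Binary.PropositionalEquality.sym e)) , Data.Sum.inj₂ (z , b , a) }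
  ; irrefl = λ { (x≢x , _) → x≢x Relation.Binary.PropositionalEquality.refl }
  }

NicheRealizable : ∀ {n} → Graph n → ℕ → Set₁
NicheRealizable {n} G k = Σ (Digraph n) λ D → IsKPartiteTournament k D × (G ≅ Niche D)

diff6 : Fin 6 → Fin 6 → ℕ
diff6 i j = (6 + toℕ i ∸ toℕ j) % 6

-- Adjacency of C6 (x_i ~ x_{i±1 mod 6}) and of G5 (additionally x_i ~ x_{i+3}),
-- vertices x_1..x_6 being Fin 6 elements 0..5.
c6b : Fin 6 → Fin 6 → Bool
c6b i j = (diff6 i j ≡ᵇ 1) ∨ (diff6 i j ≡ᵇ 5)

g5b : Fin 6 → Fin 6 → Bool
g5b i j = c6b i j ∨ (diff6 i j ≡ᵇ 3)

c6b-sym : ∀ i j → c6b i j ≡ c6b j i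
c6b-sym zero zero = refl
c6b-sym zero (suc zero) = refl
c6b-sym zero (suc (suc zero)) = refl
c6b-sym zero (suc (suc (suc zero))) = refl
c6b-sym zero (suc (suc (suc (suc zero)))) = refl
c6b-sym zero (suc (suc (suc (suc (suc zero))))) = refl
c6b-sym (suc zero) zero = refl
c6b-sym (suc zero) (suc zero) = refl
c6b-sym (suc zero) (suc (suc zero)) = refl
c6b-sym (suc zero) (suc (suc (suc zero))) = refl
c6b-sym (suc zero) (suc (suc (suc (suc zero)))) = refl
c6b-sym (suc zero) (suc (suc (suc (suc (suc zero))))) = refl
c6b-sym (suc (suc zero)) zero = refl
c6b-sym (suc (suc zero)) (suc zero) = refl
c6b-sym (suc (suc zero)) (suc (suc zero)) = refl
c6b-sym (suc (suc zero)) (suc (suc (suc zero))) = refl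
c6b-sym (suc (suc zero)) (suc (suc (suc (suc zero)))) = refl
c6b-sym (suc (suc zero)) (suc (suc (suc (suc (suc zero))))) = refl
c6b-sym (suc (suc (suc zero))) zero = refl
c6b-sym (suc (suc (suc zero))) (suc zero) = refl
c6b-sym (suc (suc (suc zero))) (suc (suc zero)) = refl
c6b-sym (suc (suc (suc zero))) (suc (suc (suc zero))) = refl
c6b-sym (suc (suc (suc zero))) (suc (suc (suc (suc zero)))) = refl
c6b-sym (suc (suc (suc zero))) (suc (suc (suc (suc (suc zero))))) = refl
c6b-sym (suc (suc (suc (suc zero)))) zero = refl
c6b-sym (suc (suc (suc (suc zero)))) (suc zero) = refl
c6b-sym (suc (suc (suc (suc zero)))) (suc (suc zero)) = refl
c6b-sym (suc (suc (suc (suc zero)))) (suc (suc (suc zero))) = refl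
c6b-sym (suc (suc (suc (suc zero)))) (suc (suc (suc (suc zero)))) = refl
c6b-sym (suc (suc (suc (suc zero)))) (suc (suc (suc (suc (suc zero))))) = refl
c6b-sym (suc (suc (suc (suc (suc zero))))) zero = refl
c6b-sym (suc (suc (suc (suc (suc zero))))) (suc zero) = refl
c6b-sym (suc (suc (suc (suc (suc zero))))) (suc (suc zero)) = refl
c6b-sym (suc (suc (suc (suc (suc zero))))) (suc (suc (suc zero))) = refl
c6b-sym (suc (suc (suc (suc (suc zero))))) (suc (suc (suc (suc zero)))) = refl
c6b-sym (suc (suc (suc (suc (suc zero))))) (suc (suc (suc (suc (suc zero))))) = refl

c6b-irr : ∀ i → c6b i i ≡ false
c6b-irr zero = refl
c6b-irr (suc zero) = refl
c6b-irr (suc (suc zero)) = refl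
c6b-irr (suc (suc (suc zero))) = refl
c6b-irr (suc (suc (suc (suc zero)))) = refl
c6b-irr (suc (suc (suc (suc (suc zero))))) = refl

g5b-sym : ∀ i j → g5b i j ≡ g5b j i
g5b-sym zero zero = refl
g5b-sym zero (suc zero) = refl
g5b-sym zero (suc (suc zero)) = refl
g5b-sym zero (suc (suc (suc zero))) = refl
g5b-sym zero (suc (suc (suc (suc zero)))) = refl
g5b-sym zero (suc (suc (suc (suc (suc zero))))) = refl
g5b-sym (suc zero) zero = refl
g5b-sym (suc zero) (suc zero) = refl
g5b-sym (suc zero) (suc (suc zero)) = refl
g5b-sym (suc zero) (suc (suc (suc zero))) = refl
g5b-sym (suc zero) (suc (suc (suc (suc zero)))) = refl
g5b-sym (suc zero) (suc (suc (suc (suc (suc zero))))) = refl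
g5b-sym (suc (suc zero)) zero = refl
g5b-sym (suc (suc zero)) (suc zero) = refl
g5b-sym (suc (suc zero)) (suc (suc zero)) = refl
g5b-sym (suc (suc zero)) (suc (suc (suc zero))) = refl
g5b-sym (suc (suc zero)) (suc (suc (suc (suc zero)))) = refl
g5b-sym (suc (suc zero)) (suc (suc (suc (suc (suc zero))))) = refl
g5b-sym (suc (suc (suc zero))) zero = refl
g5b-sym (suc (suc (suc zero))) (suc zero) = refl
g5b-sym (suc (suc (suc zero))) (suc (suc zero)) = refl
g5b-sym (suc (suc (suc zero))) (suc (suc (suc zero))) = refl
g5b-sym (suc (suc (suc zero))) (suc (suc (suc (suc zero)))) = refl
g5b-sym (suc (suc (suc zero))) (suc (suc (suc (suc (suc zero))))) = refl
g5b-sym (suc (suc (suc (suc zero)))) zero = refl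
g5b-sym (suc (suc (suc (suc zero)))) (suc zero) = refl
g5b-sym (suc (suc (suc (suc zero)))) (suc (suc zero)) = refl
g5b-sym (suc (suc (suc (suc zero)))) (suc (suc (suc zero))) = refl
g5b-sym (suc (suc (suc (suc zero)))) (suc (suc (suc (suc zero)))) = refl
g5b-sym (suc (suc (suc (suc zero)))) (suc (suc (suc (suc (suc zero))))) = refl
g5b-sym (suc (suc (suc (suc (suc zero))))) zero = refl
g5b-sym (suc (suc (suc (suc (suc zero))))) (suc zero) = refl
g5b-sym (suc (suc (suc (suc (suc zero))))) (suc (suc zero)) = refl
g5b-sym (suc (suc (suc (suc (suc zero))))) (suc (suc (suc zero))) = refl
g5b-sym (suc (suc (suc (suc (suc zero))))) (suc (suc (suc (suc zero)))) = refl
g5b-sym (suc (suc (suc (suc (suc zero))))) (suc (suc (suc (suc (suc zero))))) = refl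

g5b-irr : ∀ i → g5b i i ≡ false
g5b-irr zero = refl
g5b-irr (suc zero) = refl
g5b-irr (suc (suc zero)) = refl
g5b-irr (suc (suc (suc zero))) = refl
g5b-irr (suc (suc (suc (suc zero)))) = refl
g5b-irr (suc (suc (suc (suc (suc zero))))) = refl

boolGraph : (b : Fin 6 → Fin 6 → Bool) → (∀ i j → b i j ≡ b j i) → (∀ i → b i i ≡ false) → Graph 6
boolGraph b s r = record
  { Adj = λ i j → T (b i j)
  ; sym = λ {x} {y} t → subst T (s x y) t
  ; irrefl = λ {x} t → subst T (r x) t }

C6 : Graph 6
C6 = boolGraph c6b c6b-sym c6b-irr

G5 : Graph 6
G5 = boolGraph g5b g5b-sym g5b-irr

-- In a multipartite tournament whose niche graph is triangle-free, no vertex has three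
-- out-neighbours or three in-neighbours, for these three would be pairwise adjacent.  On six
-- vertices a vertex alone in its partite set is joined to the five others, so three of those arcs
-- point the same way; hence every partite set has at least two vertices, which forces k = 3
-- with parts of size two.  After relabelling, such a tournament is an orientation of K₂,₂,₂,
-- given by 12 bits, and checking all 4096 of them shows that each has a claw, a niche triangle,
-- a disconnected niche graph, or a niche graph isomorphic to C₆ or G₅.  Two of these
-- orientations realise C₆ and G₅.
module Submission where

open import Defs hiding (sym)
open import Data.Bool using (Bool; true; false; T; not; _∧_; _∨_; _xor_; if_then_else_)
open import Data.Bool.ListAction using (any; all)
open import Data.Bool.Properties using (T-∧; not-involutive)
open import Data.Empty using (⊥; ⊥-elim)
open import Data.Fin using (Fin; zero; suc; punchIn; remQuot)
open import Data.Fin.Patterns using (0F; 1F; 2F; 3F; 4F; 5F)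
open import Data.Fin.Properties
  using (_≟_; any?; all?; injective⇒≤; punchIn-injective; punchInᵢ≢i; *↔×)
open import Data.List using (List; []; _∷_; [_]; foldr; filterᵇ; concatMap; map; allFin)
open import Data.Maybe using (Maybe; just; nothing; _<∣>_; fromMaybe)
open import Data.Nat using (ℕ; zero; suc; _*_; _≤_; _≥_)
open import Data.Nat.Properties using (≤-antisym; *-cancelʳ-≤; n≮n)
open import Data.Product using (∃; _×_; _,_; proj₁; proj₂)
import Data.Sum as Sum
open Sum using (_⊎_; inj₁; inj₂)
open import Data.Unit using (tt)
open import Data.Vec using (Vec; []; _∷_; lookup; tabulate)
open import Data.Vec.Properties using (lookup∘tabulate)
open import Function using (_∘_; _⇔_; mk⇔; Equivalence; Injection; Surjective)
open import Function.Definitions using (Injective)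
open import Function.Bundles using (Inverse; _↔_; mk↔ₛ′)
open import Function.Construct.Composition using (_↔-∘_)
open import Function.Construct.Identity using (↔-id)
open import Function.Construct.Symmetry using (↔-sym)
open import Function.Properties.Inverse using (↔⇒↣)
open import Relation.Binary.Definitions using (Decidable)
open import Relation.Binary.PropositionalEquality
  using (_≡_; _≢_; refl; sym; trans; cong; subst; subst₂)
open import Relation.Nullary using (¬_; Dec; yes; no; ¬?; _×-dec_; _⊎-dec_; _→-dec_; contradiction)
open import Relation.Nullary.Decidable using (False; T?; isYes; toWitness; fromWitness; toWitnessFalse)

≅-sym : ∀ {n m} {G : Graph n} {H : Graph m} → G ≅ H → H ≅ G
≅-sym {H = H} (f , f-iso) = ↔-sym f , λ x y →
    (λ a → proj₂ (f-iso _ _) (subst₂ (Adj H) (sym (cancel x)) (sym (cancel y)) a))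
  , (λ a → subst₂ (Adj H) (cancel x) (cancel y) (proj₁ (f-iso _ _) a))
  where cancel = Inverse.strictlyInverseˡ f

≅-trans : ∀ {n m l} {G : Graph n} {H : Graph m} {K : Graph l} → G ≅ H → H ≅ K → G ≅ K
≅-trans (f , f-iso) (g , g-iso) = g ↔-∘ f , λ x y →
  (proj₁ (g-iso _ _) ∘ proj₁ (f-iso x y)) , (proj₂ (f-iso x y) ∘ proj₂ (g-iso _ _))

≅-triangleFree : ∀ {n m} {G : Graph n} {H : Graph m} → G ≅ H → TriangleFree G → TriangleFree H
≅-triangleFree {G = G} {H} G≅H = pull-back (≅-sym {G = G} {H} G≅H)
  where
  pull-back : H ≅ G → TriangleFree G → TriangleFree H
  pull-back (f , f-iso) tf x y z (xy , yz , xz) =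
    tf _ _ _ (proj₁ (f-iso x y) xy , proj₁ (f-iso y z) yz , proj₁ (f-iso x z) xz)

reach-map : ∀ {n m} {G : Graph n} {H : Graph m} (f : Fin n → Fin m) →
  (∀ {x y} → Adj G x y → Adj H (f x) (f y)) → ∀ {x y} → Reach G x y → Reach H (f x) (f y)
reach-map f hom here       = here
reach-map f hom (step e r) = step (hom e) (reach-map f hom r)

≅-connected : ∀ {n m} {G : Graph n} {H : Graph m} → G ≅ H → Connected G → Connected H
≅-connected {H = H} (f , f-iso) conn x y = subst₂ (Reach H) (cancel x) (cancel y)
  (reach-map (Inverse.to f) (proj₁ (f-iso _ _)) (conn (Inverse.from f x) (Inverse.from f y)))
  where cancel = Inverse.strictlyInverseˡ f

injective⇒surjective : ∀ {n} (f : Fin n → Fin n) → Injective _≡_ _≡_ f → ∀ y → ∃ λ x → f x ≡ y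
injective⇒surjective {n} f f-inj y with any? (λ x → f x ≟ y)
... | yes hit = hit
... | no miss = contradiction (injective⇒≤ f⁺-injective) (n≮n n)
  where
  f⁺ : Fin (suc n) → Fin n
  f⁺ zero    = y
  f⁺ (suc x) = f x
  f⁺-injective : Injective _≡_ _≡_ f⁺
  f⁺-injective {zero}  {zero}   _ = refl
  f⁺-injective {zero}  {suc x'} e = contradiction (x' , sym e) miss
  f⁺-injective {suc x} {zero}   e = contradiction (x , e) miss
  f⁺-injective {suc x} {suc x'} e = cong suc (f-inj e)

injective⇒↔ : ∀ {n} (f : Fin n → Fin n) → Injective _≡_ _≡_ f → Fin n ↔ Fin n
injective⇒↔ f f-inj = mk↔ₛ′ f (proj₁ ∘ surj) (proj₂ ∘ surj) (λ x → f-inj (proj₂ (surj (f x))))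
  where surj = injective⇒surjective f f-inj

ClosedNeighbourhood : ∀ {n} → Graph n → Fin n → Fin n → Set
ClosedNeighbourhood G x y = y ≡ x ⊎ Adj G x y

Separates : ∀ {n} → Graph n → Fin n → Fin n → Set
Separates G x t =
    (∀ y z → ClosedNeighbourhood G x y → Adj G y z → ClosedNeighbourhood G x z)
  × ¬ ClosedNeighbourhood G x t

separates? : ∀ {n} (G : Graph n) → Decidable (Adj G) → ∀ x t → Dec (Separates G x t)
separates? G G? x t =
  all? (λ y → all? λ z → nbhd? y →-dec G? y z →-dec nbhd? z) ×-dec ¬? (nbhd? t)
  where
  nbhd? : ∀ y → Dec (ClosedNeighbourhood G x y)
  nbhd? y = (y ≟ x) ⊎-dec G? x y

reach-closed : ∀ {n} {G : Graph n} (P : Fin n → Set) →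
  (∀ {y z} → P y → Adj G y z → P z) → ∀ {y z} → Reach G y z → P y → P z
reach-closed P closed here       py = py
reach-closed P closed (step e r) py = reach-closed P closed r (closed py e)

separates⇒disconnected : ∀ {n} {G : Graph n} {x t} → Separates G x t → ¬ Connected G
separates⇒disconnected {G = G} {x} {t} (closed , t∉) connected =
  t∉ (reach-closed (ClosedNeighbourhood G x) (closed _ _) (connected x t) (inj₁ refl))

IsoBy : ∀ {n} → Graph n → Graph n → (Fin n → Fin n) → Set
IsoBy G H π = (∀ x y → (Adj G x y → Adj H (π x) (π y)) × (Adj H (π x) (π y) → Adj G x y))
            × (∀ x y → π x ≡ π y → x ≡ y)

isoBy? : ∀ {n} (G H : Graph n) → Decidable (Adj G) → Decidable (Adj H) → ∀ π → Dec (IsoBy G H π)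
isoBy? G H G? H? π =
        all? (λ x → all? λ y → (G? x y →-dec H? (π x) (π y)) ×-dec (H? (π x) (π y) →-dec G? x y))
  ×-dec all? (λ x → all? λ y → (π x ≟ π y) →-dec (x ≟ y))

isoBy⇒≅ : ∀ {n} {G H : Graph n} {π} → IsoBy G H π → G ≅ H
isoBy⇒≅ {π = π} (preserves , π-inj) = injective⇒↔ π (π-inj _ _) , preserves

niche? : ∀ {n} {D : Digraph n} → Decidable D → Decidable (NicheAdj D)
niche? D? x y = ¬? (x ≟ y) ×-dec
  (any? (λ z → D? x z ×-dec D? y z) ⊎-dec any? (λ z → D? z x ×-dec D? z y))

niche-map : ∀ {n} {D E : Digraph n} → (∀ {x y} → D x y → E x y) →
  ∀ {x y} → NicheAdj D x y → NicheAdj E x y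
niche-map D⊆E (x≢y , inj₁ (z , xz , yz)) = x≢y , inj₁ (z , D⊆E xz , D⊆E yz)
niche-map D⊆E (x≢y , inj₂ (z , zx , zy)) = x≢y , inj₂ (z , D⊆E zx , D⊆E zy)

niche-cong : ∀ {n} {D E : Digraph n} → (∀ x y → D x y ⇔ E x y) → Niche D ≅ Niche E
niche-cong D⇔E = ↔-id _ , λ x y →
  niche-map (Equivalence.to (D⇔E _ _)) , niche-map (Equivalence.from (D⇔E _ _))

niche-relabel : ∀ {n} {D : Digraph n} (σ : Fin n ↔ Fin n) →
  Niche (λ x y → D (Inverse.to σ x) (Inverse.to σ y)) ≅ Niche D
niche-relabel {D = D} σ = σ , λ x y → forth , back
  where
  open Inverse σ using (to; from; strictlyInverseˡ)
  along : ∀ {u} w → D u w → D u (to (from w))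
  along w = subst (D _) (sym (strictlyInverseˡ w))
  along⁻ : ∀ {u} w → D w u → D (to (from w)) u
  along⁻ w = subst (λ v → D v _) (sym (strictlyInverseˡ w))
  forth : ∀ {x y} → NicheAdj (λ x y → D (to x) (to y)) x y → NicheAdj D (to x) (to y)
  forth (x≢y , inj₁ (z , xz , yz)) = x≢y ∘ Injection.injective (↔⇒↣ σ) , inj₁ (to z , xz , yz)
  forth (x≢y , inj₂ (z , zx , zy)) = x≢y ∘ Injection.injective (↔⇒↣ σ) , inj₂ (to z , zx , zy)
  back : ∀ {x y} → NicheAdj D (to x) (to y) → NicheAdj (λ x y → D (to x) (to y)) x y
  back (x≢y , inj₁ (w , xw , yw)) = x≢y ∘ cong to , inj₁ (from w , along w xw , along w yw)
  back (x≢y , inj₂ (w , wx , wy)) = x≢y ∘ cong to , inj₂ (from w , along⁻ w wx , along⁻ w wy)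

Three : ∀ {n} → (Fin n → Set) → Set
Three P = ∃ λ a → P a × ∃ λ b → a ≢ b × P b × ∃ λ c → a ≢ c × b ≢ c × P c

three : ∀ {n} {P : Fin n → Set} (a b c : Fin n)
  {a≢b : False (a ≟ b)} {b≢c : False (b ≟ c)} {a≢c : False (a ≟ c)} → P a → P b → P c → Three P
three a b c {a≢b} {b≢c} {a≢c} pa pb pc =
  a , pa , b , toWitnessFalse a≢b , pb , c , toWitnessFalse a≢c , toWitnessFalse b≢c , pc

three-map : ∀ {m n} {P : Fin n → Set} (f : Fin m → Fin n) → Injective _≡_ _≡_ f →
  Three (P ∘ f) → Three P
three-map f f-inj (a , pa , b , a≢b , pb , c , a≢c , b≢c , pc) =
  f a , pa , f b , a≢b ∘ f-inj , pb , f c , a≢c ∘ f-inj , b≢c ∘ f-inj , pc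

three-of-five : {P Q : Fin 5 → Set} → (∀ i → P i ⊎ Q i) → Three P ⊎ Three Q
three-of-five h with h 0F | h 1F | h 2F | h 3F | h 4F
... | inj₁ a | inj₁ b | inj₁ c | inj₁ _ | inj₁ _ = inj₁ (three 0F 1F 2F a b c)
... | inj₁ a | inj₁ b | inj₁ c | inj₁ _ | inj₂ _ = inj₁ (three 0F 1F 2F a b c)
... | inj₁ a | inj₁ b | inj₁ c | inj₂ _ | inj₁ _ = inj₁ (three 0F 1F 2F a b c)
... | inj₁ a | inj₁ b | inj₁ c | inj₂ _ | inj₂ _ = inj₁ (three 0F 1F 2F a b c)
... | inj₁ a | inj₁ b | inj₂ _ | inj₁ d | inj₁ _ = inj₁ (three 0F 1F 3F a b d)
... | inj₁ a | inj₁ b | inj₂ _ | inj₁ d | inj₂ _ = inj₁ (three 0F 1F 3F a b d)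
... | inj₁ a | inj₁ b | inj₂ _ | inj₂ _ | inj₁ e = inj₁ (three 0F 1F 4F a b e)
... | inj₁ _ | inj₁ _ | inj₂ c | inj₂ d | inj₂ e = inj₂ (three 2F 3F 4F c d e)
... | inj₁ a | inj₂ _ | inj₁ c | inj₁ d | inj₁ _ = inj₁ (three 0F 2F 3F a c d)
... | inj₁ a | inj₂ _ | inj₁ c | inj₁ d | inj₂ _ = inj₁ (three 0F 2F 3F a c d)
... | inj₁ a | inj₂ _ | inj₁ c | inj₂ _ | inj₁ e = inj₁ (three 0F 2F 4F a c e)
... | inj₁ _ | inj₂ b | inj₁ _ | inj₂ d | inj₂ e = inj₂ (three 1F 3F 4F b d e)
... | inj₁ a | inj₂ _ | inj₂ _ | inj₁ d | inj₁ e = inj₁ (three 0F 3F 4F a d e)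
... | inj₁ _ | inj₂ b | inj₂ c | inj₁ _ | inj₂ e = inj₂ (three 1F 2F 4F b c e)
... | inj₁ _ | inj₂ b | inj₂ c | inj₂ d | inj₁ _ = inj₂ (three 1F 2F 3F b c d)
... | inj₁ _ | inj₂ b | inj₂ c | inj₂ d | inj₂ _ = inj₂ (three 1F 2F 3F b c d)
... | inj₂ _ | inj₁ b | inj₁ c | inj₁ d | inj₁ _ = inj₁ (three 1F 2F 3F b c d)
... | inj₂ _ | inj₁ b | inj₁ c | inj₁ d | inj₂ _ = inj₁ (three 1F 2F 3F b c d)
... | inj₂ _ | inj₁ b | inj₁ c | inj₂ _ | inj₁ e = inj₁ (three 1F 2F 4F b c e)
... | inj₂ a | inj₁ _ | inj₁ _ | inj₂ d | inj₂ e = inj₂ (three 0F 3F 4F a d e)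
... | inj₂ _ | inj₁ b | inj₂ _ | inj₁ d | inj₁ e = inj₁ (three 1F 3F 4F b d e)
... | inj₂ a | inj₁ _ | inj₂ c | inj₁ _ | inj₂ e = inj₂ (three 0F 2F 4F a c e)
... | inj₂ a | inj₁ _ | inj₂ c | inj₂ d | inj₁ _ = inj₂ (three 0F 2F 3F a c d)
... | inj₂ a | inj₁ _ | inj₂ c | inj₂ d | inj₂ _ = inj₂ (three 0F 2F 3F a c d)
... | inj₂ _ | inj₂ _ | inj₁ c | inj₁ d | inj₁ e = inj₁ (three 2F 3F 4F c d e)
... | inj₂ a | inj₂ b | inj₁ _ | inj₁ _ | inj₂ e = inj₂ (three 0F 1F 4F a b e)
... | inj₂ a | inj₂ b | inj₁ _ | inj₂ d | inj₁ _ = inj₂ (three 0F 1F 3F a b d)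
... | inj₂ a | inj₂ b | inj₁ _ | inj₂ d | inj₂ _ = inj₂ (three 0F 1F 3F a b d)
... | inj₂ a | inj₂ b | inj₂ c | inj₁ _ | inj₁ _ = inj₂ (three 0F 1F 2F a b c)
... | inj₂ a | inj₂ b | inj₂ c | inj₁ _ | inj₂ _ = inj₂ (three 0F 1F 2F a b c)
... | inj₂ a | inj₂ b | inj₂ c | inj₂ _ | inj₁ _ = inj₂ (three 0F 1F 2F a b c)
... | inj₂ a | inj₂ b | inj₂ c | inj₂ _ | inj₂ _ = inj₂ (three 0F 1F 2F a b c)

Claw : ∀ {n} → Digraph n → Set
Claw D = ∃ λ x → Three (D x) ⊎ Three (λ y → D y x)

claw⇒¬triangleFree : ∀ {n} {D : Digraph n} → Claw D → ¬ TriangleFree (Niche D)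
claw⇒¬triangleFree (x , inj₁ (a , xa , b , a≢b , xb , c , a≢c , b≢c , xc)) tf =
  tf a b c ((a≢b , inj₂ (x , xa , xb)) , (b≢c , inj₂ (x , xb , xc)) , (a≢c , inj₂ (x , xa , xc)))
claw⇒¬triangleFree (x , inj₂ (a , ax , b , a≢b , bx , c , a≢c , b≢c , cx)) tf =
  tf a b c ((a≢b , inj₁ (x , ax , bx)) , (b≢c , inj₁ (x , bx , cx)) , (a≢c , inj₁ (x , ax , cx)))

-- Multipartite tournaments

module KPartite {n k} {D : Digraph n} (tournament : IsKPartiteTournament k D) where

  part : Fin n → Fin k
  part = proj₁ tournament

  intra : ∀ x y → part x ≡ part y → ¬ D x y
  intra = proj₁ (proj₂ (proj₂ tournament))

  inter : ∀ x y → part x ≢ part y → (D x y × ¬ D y x) ⊎ (D y x × ¬ D x y)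
  inter = proj₂ (proj₂ (proj₂ tournament))

  arc? : Decidable D
  arc? x y with part x ≟ part y
  ... | yes same = no (intra x y same)
  ... | no different with inter x y different
  ...   | inj₁ (xy , _)  = yes xy
  ...   | inj₂ (_ , ¬xy) = no ¬xy

  arc⇔ : ∀ {x y b} → b ≡ isYes (arc? x y) → D x y ⇔ T b
  arc⇔ {x} {y} refl = mk⇔ (fromWitness {a? = arc? x y}) (toWitness {a? = arc? x y})

  reverse-arc⇔ : ∀ {x y b} → part x ≢ part y → b ≡ isYes (arc? x y) → D y x ⇔ T (not b)
  reverse-arc⇔ {x} {y} different refl with arc? x y | inter x y different
  ... | yes _   | inj₁ (_ , ¬yx) = mk⇔ ¬yx λ ()
  ... | yes xy  | inj₂ (_ , ¬xy) = contradiction xy ¬xy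
  ... | no ¬xy  | inj₁ (xy , _)  = contradiction xy ¬xy
  ... | no _    | inj₂ (yx , _)  = mk⇔ _ λ _ → yx

  Mate : Fin n → Set
  Mate x = ∃ λ y → y ≢ x × part y ≡ part x

  mate : TriangleFree (Niche D) → ∀ x (others : Fin 5 → Fin n) →
    Injective _≡_ _≡_ others → (∀ i → others i ≢ x) → Mate x
  mate tf x others others-inj others≢x with any? (λ i → part (others i) ≟ part x)
  ... | yes (i , same) = others i , others≢x i , same
  ... | no none = contradiction tf (claw⇒¬triangleFree claw)
    where
    joined : ∀ i → D x (others i) ⊎ D (others i) x
    joined i = Sum.map proj₁ proj₁ (inter x (others i) λ e → none (i , sym e))
    claw : Claw D
    claw = x , Sum.map (three-map others others-inj) (three-map others others-inj)
                       (three-of-five joined)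

  module Pairing (surj : Surjective _≡_ _≡_ part) (mates : ∀ x → Mate x) where

    pairUp : Fin k × Fin 2 → Fin n
    pairUp (a , 0F) = proj₁ (surj a)
    pairUp (a , 1F) = proj₁ (mates (proj₁ (surj a)))

    part-pairUp : ∀ a i → part (pairUp (a , i)) ≡ a
    part-pairUp a 0F = proj₂ (surj a) refl
    part-pairUp a 1F = trans (proj₂ (proj₂ (mates _))) (proj₂ (surj a) refl)

    pairUp-parts-differ : ∀ {a b} i j → a ≢ b → part (pairUp (a , i)) ≢ part (pairUp (b , j))
    pairUp-parts-differ {a} {b} i j a≢b e =
      a≢b (trans (sym (part-pairUp a i)) (trans e (part-pairUp b j)))

    pairUp-injective : Injective _≡_ _≡_ pairUp
    pairUp-injective {a , i} {b , j} e
      with trans (sym (part-pairUp a i)) (trans (cong part e) (part-pairUp b j))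
    ... | refl = cong (a ,_) (same-copy i j e)
      where
      same-copy : ∀ i j → pairUp (a , i) ≡ pairUp (a , j) → i ≡ j
      same-copy 0F 0F _ = refl
      same-copy 0F 1F e = contradiction (sym e) (proj₁ (proj₂ (mates _)))
      same-copy 1F 0F e = contradiction e (proj₁ (proj₂ (mates _)))
      same-copy 1F 1F _ = refl

    parts≤ : k * 2 ≤ n
    parts≤ = injective⇒≤ (λ e → Injection.injective (↔⇒↣ *↔×) (pairUp-injective e))

mates₆ : ∀ {k} {D : Digraph 6} (tournament : IsKPartiteTournament k D) → TriangleFree (Niche D) →
  ∀ x → KPartite.Mate tournament x
mates₆ tournament tf x =
  KPartite.mate tournament tf x (punchIn x) (λ {i} {j} → punchIn-injective x i j) (punchInᵢ≢i x)

-- Orientations of K₂,₂,₂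

-- Quotient and remainder by 2, spelled out so that the exhaustive check evaluates them quickly.
block : Fin 6 → Fin 3
block 0F = 0F
block 1F = 0F
block 2F = 1F
block 3F = 1F
block 4F = 2F
block 5F = 2F

copy : Fin 6 → Fin 2
copy 0F = 0F
copy 1F = 1F
copy 2F = 0F
copy 3F = 1F
copy 4F = 0F
copy 5F = 1F

remQuot-block-copy : ∀ x → remQuot {3} 2 x ≡ (block x , copy x)
remQuot-block-copy 0F = refl
remQuot-block-copy 1F = refl
remQuot-block-copy 2F = refl
remQuot-block-copy 3F = refl
remQuot-block-copy 4F = refl
remQuot-block-copy 5F = refl

block-copy-injective : ∀ {x y} → (block x , copy x) ≡ (block y , copy y) → x ≡ y
block-copy-injective {x} {y} e = Injection.injective (↔⇒↣ *↔×)
  (trans (remQuot-block-copy x) (trans e (sym (remQuot-block-copy y))))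

-- Bit (p, i, j) orients the edge between copy i of block a and copy j of block b, where
-- (a, b) is (0, 1), (0, 2) or (1, 2) for p = 0, 1 or 2; the bit true means a → b.
Orientation : Set
Orientation = Vec (Vec (Vec Bool 2) 2) 3

bit : Orientation → Fin 3 → Fin 2 → Fin 2 → Bool
bit o p i j = lookup (lookup (lookup o p) i) j

orientation : (Fin 3 → Fin 2 → Fin 2 → Bool) → Orientation
orientation f = tabulate λ p → tabulate λ i → tabulate (f p i)

bit-orientation : ∀ f p i j → bit (orientation f) p i j ≡ f p i j
bit-orientation f p i j
  rewrite lookup∘tabulate (λ p → tabulate λ i → tabulate (f p i)) p
        | lookup∘tabulate (λ i → tabulate (f p i)) i
        | lookup∘tabulate (f p i) j = refl

crossing : Orientation → Fin 3 → Fin 2 → Fin 3 → Fin 2 → Bool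
crossing o 0F i 1F j = bit o 0F i j
crossing o 0F i 2F j = bit o 1F i j
crossing o 1F i 2F j = bit o 2F i j
crossing o 1F i 0F j = not (bit o 0F j i)
crossing o 2F i 0F j = not (bit o 1F j i)
crossing o 2F i 1F j = not (bit o 2F j i)
crossing o _  _ _  _ = false

crossing-same : ∀ o a i j → crossing o a i a j ≡ false
crossing-same o 0F i j = refl
crossing-same o 1F i j = refl
crossing-same o 2F i j = refl

crossing-reverse : ∀ o a i b j → a ≢ b → crossing o b j a i ≡ not (crossing o a i b j)
crossing-reverse o 0F i 0F j a≢b = contradiction refl a≢b
crossing-reverse o 0F i 1F j _   = refl
crossing-reverse o 0F i 2F j _   = refl
crossing-reverse o 1F i 0F j _   = sym (not-involutive _)
crossing-reverse o 1F i 1F j a≢b = contradiction refl a≢b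
crossing-reverse o 1F i 2F j _   = refl
crossing-reverse o 2F i 0F j _   = sym (not-involutive _)
crossing-reverse o 2F i 1F j _   = sym (not-involutive _)
crossing-reverse o 2F i 2F j a≢b = contradiction refl a≢b

canonical : Orientation → Digraph 6
canonical o x y = T (crossing o (block x) (copy x) (block y) (copy y))

canonical? : ∀ o → Decidable (canonical o)
canonical? o x y = T? _

canonical-tournament : ∀ o → IsKPartiteTournament 3 (canonical o)
canonical-tournament o = block , block-surjective , intra , inter
  where
  block-surjective : Surjective _≡_ _≡_ block
  block-surjective 0F = 0F , λ { refl → refl }
  block-surjective 1F = 2F , λ { refl → refl }
  block-surjective 2F = 4F , λ { refl → refl }
  intra : ∀ x y → block x ≡ block y → ¬ canonical o x y
  intra x y e = subst T (crossing-same o (block x) (copy x) (copy y))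
              ∘ subst (λ b → T (crossing o (block x) (copy x) b (copy y))) (sym e)
  exactly-one : ∀ b → (T b × ¬ T (not b)) ⊎ (T (not b) × ¬ T b)
  exactly-one true  = inj₁ (_ , λ ())
  exactly-one false = inj₂ (_ , λ ())
  inter : ∀ x y → block x ≢ block y →
    (canonical o x y × ¬ canonical o y x) ⊎ (canonical o y x × ¬ canonical o x y)
  inter x y different = subst (λ c → (T b × ¬ T c) ⊎ (T c × ¬ T b))
    (sym (crossing-reverse o (block x) (copy x) (block y) (copy y) different)) (exactly-one b)
    where b = crossing o (block x) (copy x) (block y) (copy y)

module Relabelling {D : Digraph 6} (tournament : IsKPartiteTournament 3 D)
                   (tf : TriangleFree (Niche D)) where

  open KPartite tournament

  mates : ∀ x → Mate x
  mates = mates₆ tournament tf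

  open Pairing (proj₁ (proj₂ tournament)) mates

  vertex : Fin 3 → Fin 2 → Fin 6
  vertex a i = pairUp (a , i)

  no-arc : ∀ a i j → D (vertex a i) (vertex a j) ⇔ T false
  no-arc a i j = mk⇔ (intra _ _ (trans (part-pairUp a i) (sym (part-pairUp a j)))) λ ()

  arc-bits : Fin 3 → Fin 2 → Fin 2 → Bool
  arc-bits 0F i j = isYes (arc? (vertex 0F i) (vertex 1F j))
  arc-bits 1F i j = isYes (arc? (vertex 0F i) (vertex 2F j))
  arc-bits 2F i j = isYes (arc? (vertex 1F i) (vertex 2F j))

  orientation-of-D : Orientation
  orientation-of-D = orientation arc-bits

  arc⇔crossing : ∀ a i b j → D (vertex a i) (vertex b j) ⇔ T (crossing orientation-of-D a i b j)
  arc⇔crossing 0F i 0F j = no-arc 0F i j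
  arc⇔crossing 0F i 1F j = arc⇔ (bit-orientation arc-bits 0F i j)
  arc⇔crossing 0F i 2F j = arc⇔ (bit-orientation arc-bits 1F i j)
  arc⇔crossing 1F i 0F j = reverse-arc⇔ (pairUp-parts-differ j i λ ()) (bit-orientation arc-bits 0F j i)
  arc⇔crossing 1F i 1F j = no-arc 1F i j
  arc⇔crossing 1F i 2F j = arc⇔ (bit-orientation arc-bits 2F i j)
  arc⇔crossing 2F i 0F j = reverse-arc⇔ (pairUp-parts-differ j i λ ()) (bit-orientation arc-bits 1F j i)
  arc⇔crossing 2F i 1F j = reverse-arc⇔ (pairUp-parts-differ j i λ ()) (bit-orientation arc-bits 2F j i)
  arc⇔crossing 2F i 2F j = no-arc 2F i j

  relabelling : Fin 6 ↔ Fin 6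
  relabelling =
    injective⇒↔ (λ x → vertex (block x) (copy x)) (block-copy-injective ∘ pairUp-injective)

  Relabelled : Digraph 6
  Relabelled x y = D (vertex (block x) (copy x)) (vertex (block y) (copy y))

  niche≅canonical : Niche D ≅ Niche (canonical orientation-of-D)
  niche≅canonical = ≅-trans {G = Niche D} {Niche Relabelled} {Niche (canonical orientation-of-D)}
    (≅-sym {G = Niche Relabelled} {Niche D} (niche-relabel {D = D} relabelling))
    (niche-cong λ x y → arc⇔crossing (block x) (copy x) (block y) (copy y))

C6? : Decidable (Adj C6)
C6? x y = T? _

G5? : Decidable (Adj G5)
G5? x y = T? _

data Certificate : Set where
  out-claw in-claw : (x a b c : Fin 6) → Certificate
  triangle         : (x y z : Fin 6) → Certificate
  separation       : (x t : Fin 6) → Certificate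
  iso-C6 iso-G5    : (π : Fin 6 → Fin 6) → Certificate
  none             : Certificate

Valid : Digraph 6 → Certificate → Set
Valid D (out-claw x a b c) = D x a × a ≢ b × D x b × a ≢ c × b ≢ c × D x c
Valid D (in-claw x a b c)  = D a x × a ≢ b × D b x × a ≢ c × b ≢ c × D c x
Valid D (triangle x y z)   = NicheAdj D x y × NicheAdj D y z × NicheAdj D x z
Valid D (separation x t)   = Separates (Niche D) x t
Valid D (iso-C6 π)         = IsoBy (Niche D) C6 π
Valid D (iso-G5 π)         = IsoBy (Niche D) G5 π
Valid D none               = ⊥

valid? : ∀ {D} → Decidable D → ∀ c → Dec (Valid D c)
valid? D? (out-claw x a b c) =
  D? x a ×-dec ¬? (a ≟ b) ×-dec D? x b ×-dec ¬? (a ≟ c) ×-dec ¬? (b ≟ c) ×-dec D? x c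
valid? D? (in-claw x a b c) =
  D? a x ×-dec ¬? (a ≟ b) ×-dec D? b x ×-dec ¬? (a ≟ c) ×-dec ¬? (b ≟ c) ×-dec D? c x
valid? D? (triangle x y z)       = niche? D? x y ×-dec niche? D? y z ×-dec niche? D? x z
valid? {D} D? (separation x t)   = separates? (Niche D) (niche? D?) x t
valid? {D} D? (iso-C6 π)         = isoBy? (Niche D) C6 (niche? D?) C6? π
valid? {D} D? (iso-G5 π)         = isoBy? (Niche D) G5 (niche? D?) G5? π
valid? D? none                   = no λ ()

valid⇒C6⊎G5 : ∀ {D} c → Valid D c → TriangleFree (Niche D) → Connected (Niche D) →
  Niche D ≅ C6 ⊎ Niche D ≅ G5
valid⇒C6⊎G5 {D} (out-claw x a b c) (xa , a≢b , xb , a≢c , b≢c , xc) tf _ =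
  ⊥-elim (claw⇒¬triangleFree {D = D} (x , inj₁ (a , xa , b , a≢b , xb , c , a≢c , b≢c , xc)) tf)
valid⇒C6⊎G5 {D} (in-claw x a b c) (ax , a≢b , bx , a≢c , b≢c , cx) tf _ =
  ⊥-elim (claw⇒¬triangleFree {D = D} (x , inj₂ (a , ax , b , a≢b , bx , c , a≢c , b≢c , cx)) tf)
valid⇒C6⊎G5 (triangle x y z) xyz tf _ = contradiction xyz (tf x y z)
valid⇒C6⊎G5 (separation x t) separates _ connected =
  ⊥-elim (separates⇒disconnected separates connected)
valid⇒C6⊎G5 {D} (iso-C6 π) iso _ _ = inj₁ (isoBy⇒≅ {G = Niche D} {C6} iso)
valid⇒C6⊎G5 {D} (iso-G5 π) iso _ _ = inj₂ (isoBy⇒≅ {G = Niche D} {G5} iso)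

-- The search for certificates: it needs no correctness proof, since its answers are checked.
module Search where

  Matrix : Set
  Matrix = Vec (Vec Bool 6) 6

  -- Tabulating a relation before it is queried repeatedly lets Agda's call-by-need
  -- evaluator compute each entry once.
  tabulate₂ : (Fin 6 → Fin 6 → Bool) → Matrix
  tabulate₂ r = tabulate λ x → tabulate (r x)

  entry : Matrix → Fin 6 → Fin 6 → Bool
  entry m x y = lookup (lookup m x) y

  vertices : List (Fin 6)
  vertices = allFin 6

  firstJust : {A B : Set} → (A → Maybe B) → List A → Maybe B
  firstJust f = foldr (λ a rest → f a <∣> rest) nothing

  _==_ : Fin 6 → Fin 6 → Bool
  x == y = isYes (x ≟ y)

  three-of : List (Fin 6) → (Fin 6 → Fin 6 → Fin 6 → Certificate) → Maybe Certificate
  three-of (a ∷ b ∷ c ∷ _) k = just (k a b c)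
  three-of _               k = nothing

  findClaw : (Fin 6 → Fin 6 → Bool) → Maybe Certificate
  findClaw arc = firstJust (λ x → three-of (filterᵇ (arc x) vertices) (out-claw x)
                              <∣> three-of (filterᵇ (λ y → arc y x) vertices) (in-claw x)) vertices

  niche : Matrix → Fin 6 → Fin 6 → Bool
  niche m x y = not (x == y) ∧ (any (λ z → entry m x z ∧ entry m y z) vertices
                              ∨ any (λ z → entry m z x ∧ entry m z y) vertices)

  findTriangle : Matrix → Maybe Certificate
  findTriangle m = firstJust (λ x → firstJust (λ y → firstJust (λ z →
    if entry m x y ∧ entry m y z ∧ entry m x z then just (triangle x y z) else nothing)
    vertices) vertices) vertices

  findSeparation : Matrix → Maybe Certificate
  findSeparation m = firstJust (λ x →
    if all (λ y → all (λ z → not (nbhd x y ∧ entry m y z) ∨ nbhd x z) vertices) vertices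
    then firstJust (λ t → if nbhd x t then nothing else just (separation x t)) vertices
    else nothing) vertices
    where nbhd = λ x y → (y == x) ∨ entry m x y

  permutations : ∀ n → List (Fin n → Fin n)
  permutations zero    = [ (λ x → x) ]
  permutations (suc n) = concatMap (λ i → map (extend i) (permutations n)) (allFin _)
    where
    extend : Fin (suc n) → (Fin n → Fin n) → Fin (suc n) → Fin (suc n)
    extend i π zero    = i
    extend i π (suc x) = punchIn i (π x)

  findIso : Matrix → (Fin 6 → Fin 6 → Bool) → ((Fin 6 → Fin 6) → Certificate) → Maybe Certificate
  findIso m h k = firstJust (λ π →
    if all (λ x → all (λ y → not (entry m x y xor h (π x) (π y))) vertices) vertices
    then just (k π) else nothing) (permutations 6)

  findInNiche : Matrix → Maybe Certificate
  findInNiche m =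
    findTriangle m <∣> findSeparation m <∣> findIso m c6b iso-C6 <∣> findIso m g5b iso-G5

  certificate : Orientation → Certificate
  certificate o = fromMaybe none (findClaw arc <∣> findInNiche (tabulate₂ (niche (tabulate₂ arc))))
    where arc = λ x y → crossing o (block x) (copy x) (block y) (copy y)

open Search using (certificate)

-- The exhaustive check

Exhaustive : (A : Set) → ((A → Bool) → Bool) → Set
Exhaustive A every = ∀ p → T (every p) → ∀ a → T (p a)

everyBool : (Bool → Bool) → Bool
everyBool p = p true ∧ p false

everyBool-exhaustive : Exhaustive Bool everyBool
everyBool-exhaustive p holds true  = proj₁ (Equivalence.to T-∧ holds)
everyBool-exhaustive p holds false = proj₂ (Equivalence.to T-∧ holds)

everyVec : ∀ {A : Set} n → ((A → Bool) → Bool) → (Vec A n → Bool) → Bool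
everyVec zero    every p = p []
everyVec (suc n) every p = every λ a → everyVec n every (p ∘ (a ∷_))

everyVec-exhaustive : ∀ {A : Set} {every} n →
  Exhaustive A every → Exhaustive (Vec A n) (everyVec n every)
everyVec-exhaustive zero    exhaustive p holds []      = holds
everyVec-exhaustive (suc n) exhaustive p holds (a ∷ v) =
  everyVec-exhaustive n exhaustive (p ∘ (a ∷_)) (exhaustive _ holds a) v

everyOrientation : (Orientation → Bool) → Bool
everyOrientation = everyVec 3 (everyVec 2 (everyVec 2 everyBool))

everyOrientation-exhaustive : Exhaustive Orientation everyOrientation
everyOrientation-exhaustive =
  everyVec-exhaustive 3 (everyVec-exhaustive 2 (everyVec-exhaustive 2 everyBool-exhaustive))

-- The argument tt makes Agda evaluate the check for all 4096 orientations.
certified : ∀ o → Valid (canonical o) (certificate o)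
certified =
  toWitness ∘ everyOrientation-exhaustive (λ o → isYes (valid? (canonical? o) (certificate o))) tt

≅-realizable : ∀ {G H : Graph 6} {k} → G ≅ H → NicheRealizable H k → NicheRealizable G k
≅-realizable {G} {H} G≅H (D , tournament , H≅N) =
  D , tournament , ≅-trans {G = G} {H} {Niche D} G≅H H≅N

parts≤3 : ∀ {G : Graph 6} {k} → TriangleFree G → NicheRealizable G k → k ≤ 3
parts≤3 {G} {k} tf (D , tournament , G≅N) = *-cancelʳ-≤ k 3 2
  (KPartite.Pairing.parts≤ tournament (proj₁ (proj₂ tournament))
    (mates₆ tournament (≅-triangleFree {G = G} {Niche D} G≅N tf)))

realization⇒C6⊎G5 : ∀ {G : Graph 6} → Connected G → TriangleFree G → NicheRealizable G 3 →
  G ≅ C6 ⊎ G ≅ G5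
realization⇒C6⊎G5 {G} connected tf (D , tournament , G≅N) =
  Sum.map (≅-trans {G = G} {C} {C6} G≅C) (≅-trans {G = G} {C} {G5} G≅C)
    (valid⇒C6⊎G5 (certificate o) (certified o) tf-C connected-C)
  where
  open Relabelling tournament (≅-triangleFree {G = G} {Niche D} G≅N tf)
  o = orientation-of-D
  C = Niche (canonical o)
  G≅C : G ≅ C
  G≅C = ≅-trans {G = G} {Niche D} {C} G≅N niche≅canonical
  tf-C : TriangleFree C
  tf-C = ≅-triangleFree {G = G} {C} G≅C tf
  connected-C : Connected C
  connected-C = ≅-connected {G = G} {C} G≅C connected

C6-orientation : Orientation
C6-orientation = ((false ∷ true ∷ []) ∷ (true ∷ false ∷ []) ∷ [])
               ∷ ((false ∷ true ∷ []) ∷ (true ∷ false ∷ []) ∷ [])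
               ∷ ((false ∷ true ∷ []) ∷ (true ∷ false ∷ []) ∷ []) ∷ []

G5-orientation : Orientation
G5-orientation = ((false ∷ false ∷ []) ∷ (false ∷ true ∷ []) ∷ [])
               ∷ ((true ∷ true ∷ []) ∷ (true ∷ false ∷ []) ∷ [])
               ∷ ((false ∷ false ∷ []) ∷ (false ∷ true ∷ []) ∷ []) ∷ []

canonical-realizes : ∀ {H : Graph 6} o → Niche (canonical o) ≅ H → NicheRealizable H 3
canonical-realizes {H} o N≅H = canonical o , canonical-tournament o , ≅-sym {G = Niche (canonical o)} {H} N≅H

C6⊎G5⇒realizable : ∀ {G : Graph 6} → G ≅ C6 ⊎ G ≅ G5 → NicheRealizable G 3
C6⊎G5⇒realizable {G} (inj₁ G≅C6) = ≅-realizable {G = G} {C6} G≅C6 (canonical-realizes {C6} C6-orientation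
  (isoBy⇒≅ {G = Niche (canonical C6-orientation)} {H = C6} (certified C6-orientation)))
C6⊎G5⇒realizable {G} (inj₂ G≅G5) = ≅-realizable {G = G} {G5} G≅G5 (canonical-realizes {G5} G5-orientation
  (isoBy⇒≅ {G = Niche (canonical G5-orientation)} {H = G5} (certified G5-orientation)))

lemma4p11 : (G : Graph 6) → Connected G → TriangleFree G → (k : ℕ) → k ≥ 3 →
    (NicheRealizable G k → (k ≡ 3 × (G ≅ C6 ⊎ G ≅ G5)))
    × ((k ≡ 3 × (G ≅ C6 ⊎ G ≅ G5)) → NicheRealizable G k)
lemma4p11 G connected tf k k≥3 = forward , backward
  where
  forward : NicheRealizable G k → k ≡ 3 × (G ≅ C6 ⊎ G ≅ G5)
  forward realization with ≤-antisym (parts≤3 {G} tf realization) k≥3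
  ... | refl = refl , realization⇒C6⊎G5 {G} connected tf realization
  backward : k ≡ 3 × (G ≅ C6 ⊎ G ≅ G5) → NicheRealizable G k
  backward (refl , G≅) = C6⊎G5⇒realizable {G} G≅
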